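{- Let $\langle A,\rightarrow_1,\top\rangle$ and $\langle A,\rightarrow_2,\top\rangle$ be BCI-algebras with induced partial orders $\leq_1$ and $\leq_2$ respectively. Suppose that $\leq_2$ extends $\leq_1$ (i.e. $x\leq_1 y$ implies $x\leq_2 y$), that $x\rightarrow_1 y\leq_2 x\rightarrow_2 y$ for all $x,y\in A$, and that for all $w,x,y,z\in A$, $w\leq_2 x\leq_1 y\leq_2 z$ implies $w\leq_1 z$. Then $\langle A,\rightarrow_1,\rightarrow_2,\top\rangle$ is a Semi-BCI algebra. Likewise, if both are BCK-algebras, then $\langle A,\rightarrow_1,\rightarrow_2,\top\rangle$ is a Semi-BCK algebra.
   Context: A BCI-algebra is a structure $\langle A,\rightarrow,\top\rangle$ such that for all $x,y,z\in A$: (C1) $(y\rightarrow z)\rightarrow((z\rightarrow x)\rightarrow(y\rightarrow x))=\top$; (C2) $x\rightarrow((x\rightarrow y)\rightarrow y)=\top$; (C3) $x\rightarrow x=\top$; (C4) $x\rightarrow y=\top$ and $y\rightarrow x=\top$ imply $x=y$; its induced partial order is $x\leq y$ iff $x\rightarrow y=\top$; it is a BCK-algebra if moreover $x\rightarrow\top=\top$ for all $x$. A Semi-BCI (SBCI) algebra is a structure $\langle A,\twoheadrightarrow,\rightarrow,\top\rangle$ with two binary operations and $\top\in A$, where $x\ll y$ iff $x\twoheadrightarrow y=\top$ and $x\preceq y$ iff $x\rightarrow y=\top$, such that for all $x,y,z$: (S1) $x\twoheadrightarrow(y\twoheadrightarrow z)=y\twoheadrightarrow(x\twoheadrightarrow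 z)$; (S2) $x\rightarrow(y\rightarrow z)=y\rightarrow(x\rightarrow z)$; (S3) $x\twoheadrightarrow y\preceq(z\twoheadrightarrow x)\rightarrow(z\twoheadrightarrow y)$; (S4) $\top\twoheadrightarrow x=x$; (S5) if $x\ll y\preceq z$ then $x\ll z$; (S6) if $x\preceq y\ll z$ then $x\ll z$; (S7) if $x\preceq y$ and $y\preceq x$ then $x=y$. A Semi-BCK (SBCK) algebra is an SBCI algebra with $x\ll\top$ for all $x\in A$. -}

module Defs where

open import Level using (Level)
open import Relation.Binary.PropositionalEquality using (_≡_)
open import Data.Product using (_×_)

Op : ∀ {a} → Set a → Set a
Op A = A → A → A

record IsBCI {a} (A : Set a) (_⇒_ : Op A) (⊤ : A) : Set a where
  field
    C1 : ∀ x y z → (y ⇒ z) ⇒ ((z ⇒ x) ⇒ (y ⇒ x)) ≡ ⊤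
    C2 : ∀ x y → x ⇒ ((x ⇒ y) ⇒ y) ≡ ⊤
    C3 : ∀ x → x ⇒ x ≡ ⊤
    C4 : ∀ x y → x ⇒ y ≡ ⊤ → y ⇒ x ≡ ⊤ → x ≡ y

record IsBCK {a} (A : Set a) (_⇒_ : Op A) (⊤ : A) : Set a where
  field
    isBCI : IsBCI A _⇒_ ⊤
    K : ∀ x → x ⇒ ⊤ ≡ ⊤

Le : ∀ {a} {A : Set a} → Op A → A → A → A → Set a
Le _⇒_ ⊤ x y = x ⇒ y ≡ ⊤

record IsSBCI {a} (A : Set a) (_↠_ : Op A) (_⇒_ : Op A) (⊤ : A) : Set a where
  _≪_ : A → A → Set a
  x ≪ y = x ↠ y ≡ ⊤
  _≼_ : A → A → Set a
  x ≼ y = x ⇒ y ≡ ⊤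
  field
    S1 : ∀ x y z → x ↠ (y ↠ z) ≡ y ↠ (x ↠ z)
    S2 : ∀ x y z → x ⇒ (y ⇒ z) ≡ y ⇒ (x ⇒ z)
    S3 : ∀ x y z → (x ↠ y) ≼ ((z ↠ x) ⇒ (z ↠ y))
    S4 : ∀ x → ⊤ ↠ x ≡ x
    S5 : ∀ x y z → x ≪ y → y ≼ z → x ≪ z
    S6 : ∀ x y z → x ≼ y → y ≪ z → x ≪ z
    S7 : ∀ x y → x ≼ y → y ≼ x → x ≡ y

record IsSBCK {a} (A : Set a) (_↠_ : Op A) (_⇒_ : Op A) (⊤ : A) : Set a where
  field
    isSBCI : IsSBCI A _↠_ _⇒_ ⊤
    K : ∀ x → x ↠ ⊤ ≡ ⊤

module Submission where

open import Defs
open import Data.Product using (_×_; _,_)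
open import Relation.Binary.PropositionalEquality using (_≡_; sym; trans; subst)

module BCI-Properties {a} {A : Set a} {_⇒_ : Op A} {⊤ : A}
                      (bci : IsBCI A _⇒_ ⊤) where
  open IsBCI bci

  _≤_ : A → A → Set a
  _≤_ = Le _⇒_ ⊤

  below-⊤⇒ : ∀ x → x ≤ (⊤ ⇒ x)
  below-⊤⇒ x = subst (λ t → x ≤ (t ⇒ x)) (C3 x) (C2 x x)

  ⊤-maximal : ∀ x → ⊤ ≤ x → x ≡ ⊤
  ⊤-maximal x ⊤≤x = C4 x ⊤ x≤⊤ ⊤≤x
    where
    x≤⊤ : x ≤ ⊤
    x≤⊤ = subst (λ t → x ≤ t) ⊤≤x (below-⊤⇒ x)

  ⊤-identityˡ : ∀ x → ⊤ ⇒ x ≡ x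
  ⊤-identityˡ x = C4 (⊤ ⇒ x) x (⊤-maximal _ (C2 ⊤ x)) (below-⊤⇒ x)

  modus-ponens : ∀ {x y} → x ≡ ⊤ → x ≤ y → y ≡ ⊤
  modus-ponens {x} {y} x≡⊤ x≤y =
    trans (sym (⊤-identityˡ y)) (subst (λ t → t ≤ y) x≡⊤ x≤y)

  ⇒-antitone : ∀ {x y} z → x ≤ y → (y ⇒ z) ≤ (x ⇒ z)
  ⇒-antitone {x} {y} z x≤y = modus-ponens x≤y (C1 z x y)

  ≤-trans : ∀ {x y z} → x ≤ y → y ≤ z → x ≤ z
  ≤-trans {x} {y} {z} x≤y y≤z = modus-ponens y≤z (⇒-antitone z x≤y)

  -- One half of exchange, via x ⇒ (y ⇒ z) ≤ ((y ⇒ z) ⇒ z) ⇒ (x ⇒ z) ≤ y ⇒ (x ⇒ z).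
  exchange-≤ : ∀ x y z → (x ⇒ (y ⇒ z)) ≤ (y ⇒ (x ⇒ z))
  exchange-≤ x y z =
    ≤-trans (C1 z x (y ⇒ z)) (⇒-antitone (x ⇒ z) (C2 y z))

  exchange : ∀ x y z → x ⇒ (y ⇒ z) ≡ y ⇒ (x ⇒ z)
  exchange x y z = C4 _ _ (exchange-≤ x y z) (exchange-≤ y x z)

  -- Suffixing law: C1 with its two premises exchanged.
  suffixing : ∀ x y z → (x ⇒ y) ≤ ((z ⇒ x) ⇒ (z ⇒ y))
  suffixing x y z = trans (exchange (x ⇒ y) (z ⇒ x) (z ⇒ y)) (C1 y z x)

module Combination {a} {A : Set a} {_⇒₁_ _⇒₂_ : Op A} {⊤ : A}
    (≤₁⊆≤₂   : ∀ x y → Le _⇒₁_ ⊤ x y → Le _⇒₂_ ⊤ x y)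
    (⇒₁≤₂⇒₂  : ∀ x y → Le _⇒₂_ ⊤ (x ⇒₁ y) (x ⇒₂ y))
    (sandwich : ∀ w x y z → Le _⇒₂_ ⊤ w x → Le _⇒₁_ ⊤ x y → Le _⇒₂_ ⊤ y z
                          → Le _⇒₁_ ⊤ w z)
    (bci₁ : IsBCI A _⇒₁_ ⊤) (bci₂ : IsBCI A _⇒₂_ ⊤) where

  module P₁ = BCI-Properties bci₁
  module P₂ = BCI-Properties bci₂

  -- S3: x ⇒₁ y ≤₂ (z ⇒₁ x) ⇒₁ (z ⇒₁ y) ≤₂ (z ⇒₁ x) ⇒₂ (z ⇒₁ y).
  mixed-suffixing : ∀ x y z → Le _⇒₂_ ⊤ (x ⇒₁ y) ((z ⇒₁ x) ⇒₂ (z ⇒₁ y))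
  mixed-suffixing x y z =
    P₂.≤-trans (≤₁⊆≤₂ _ _ (P₁.suffixing x y z)) (⇒₁≤₂⇒₂ _ _)

  isSBCI : IsSBCI A _⇒₁_ _⇒₂_ ⊤
  isSBCI = record
    { S1 = P₁.exchange
    ; S2 = P₂.exchange
    ; S3 = mixed-suffixing
    ; S4 = P₁.⊤-identityˡ
    ; S5 = λ x y z x≤₁y y≤₂z → sandwich x x y z (IsBCI.C3 bci₂ x) x≤₁y y≤₂z
    ; S6 = λ x y z x≤₂y y≤₁z → sandwich x y z z x≤₂y y≤₁z (IsBCI.C3 bci₂ z)
    ; S7 = IsBCI.C4 bci₂
    }

proposition10 : ∀ {a} (A : Set a) (_⇒₁_ _⇒₂_ : Op A) (⊤ : A)
    → (∀ x y → Le _⇒₁_ ⊤ x y → Le _⇒₂_ ⊤ x y)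
    → (∀ x y → Le _⇒₂_ ⊤ (x ⇒₁ y) (x ⇒₂ y))
    → (∀ w x y z → Le _⇒₂_ ⊤ w x → Le _⇒₁_ ⊤ x y → Le _⇒₂_ ⊤ y z → Le _⇒₁_ ⊤ w z)
    → (IsBCI A _⇒₁_ ⊤ → IsBCI A _⇒₂_ ⊤ → IsSBCI A _⇒₁_ _⇒₂_ ⊤)
      × (IsBCK A _⇒₁_ ⊤ → IsBCK A _⇒₂_ ⊤ → IsSBCK A _⇒₁_ _⇒₂_ ⊤)
proposition10 A _⇒₁_ _⇒₂_ ⊤ ≤₁⊆≤₂ ⇒₁≤₂⇒₂ sandwich = sbci , sbck
  where
  sbci : IsBCI A _⇒₁_ ⊤ → IsBCI A _⇒₂_ ⊤ → IsSBCI A _⇒₁_ _⇒₂_ ⊤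
  sbci = Combination.isSBCI ≤₁⊆≤₂ ⇒₁≤₂⇒₂ sandwich

  sbck : IsBCK A _⇒₁_ ⊤ → IsBCK A _⇒₂_ ⊤ → IsSBCK A _⇒₁_ _⇒₂_ ⊤
  sbck bck₁ bck₂ = record
    { isSBCI = sbci (IsBCK.isBCI bck₁) (IsBCK.isBCI bck₂)
    ; K      = IsBCK.K bck₁
    }
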